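{- Let $\Pi$ be a uniformly random permutation of $\{1,\ldots,n\}$, let $N_n$ be the number of cycles of $\Pi$, and for integers $n,s\geq 1$ let $\mu_{n,s} = \mathbb{E} N_n^s$ (with $\mu_{0,s} := 0$). Then for all integers $n,s \geq 1$, \[ \mu_{n,s} = 1 + \frac{1}{n}\sum_{r=1}^{s}\sum_{j=1}^{n-1}\binom{s}{r}\mu_{j,r}. \]
   Context: A uniformly random permutation $\Pi$ of $\{1,\ldots,n\}$ satisfies $\mathbb{P}(\Pi = \pi) = 1/n!$ for every permutation $\pi$. A cycle of length $k$ of a permutation $\pi$ is a $k$-tuple $(i_1,\ldots,i_k)$ with $\pi(i_j) = i_{j+1}$ for $1\le j\le k-1$ and $\pi(i_k)=i_1$; every element lies in exactly one cycle. -}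

module Defs where

open import Data.Bool using (Bool; true; false; _∧_; _∨_; not)
open import Data.Nat using (ℕ; zero; suc; _^_; _≤ᵇ_; _!; NonZero)
open import Data.Nat.Properties using (_!≢0)
open import Data.Fin using (Fin; toℕ) renaming (_≟_ to _≟ᶠ_)
open import Data.List using (List; []; _∷_; [_]; map; concatMap; filterᵇ; length; allFin; upTo; foldr)
open import Data.Bool.ListAction using (and)
open import Data.Nat.ListAction using (sum)
open import Data.Vec using (Vec; lookup) renaming ([] to []ᵛ; _∷_ to _∷ᵛ_)
open import Data.Integer using (+_)
open import Data.Rational using (ℚ; _/_; _+_; 0ℚ)
open import Relation.Nullary.Decidable using (⌊_⌋)

all : {A : Set} → (A → Bool) → List A → Bool
all p xs = and (map p xs)

allVecs : (m k : ℕ) → List (Vec (Fin k) m)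
allVecs zero    k = [ []ᵛ ]
allVecs (suc m) k = concatMap (λ x → map (x ∷ᵛ_) (allVecs m k)) (allFin k)

-- v (as a map Fin n → Fin n) is injective, hence a permutation.
isPerm : {n : ℕ} → Vec (Fin n) n → Bool
isPerm {n} v = all (λ i → all (λ j → not ⌊ lookup v i ≟ᶠ lookup v j ⌋ ∨ ⌊ i ≟ᶠ j ⌋) (allFin n)) (allFin n)

perms : (n : ℕ) → List (Vec (Fin n) n)
perms n = filterᵇ isPerm (allVecs n n)

iter : {A : Set} → (A → A) → ℕ → A → A
iter f zero    x = x
iter f (suc k) x = f (iter f k x)

isCycleMin : {n : ℕ} → Vec (Fin n) n → Fin n → Bool
isCycleMin {n} v i = all (λ k → toℕ i ≤ᵇ toℕ (iter (lookup v) k i)) (upTo (suc n))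

-- Number of cycles: every cycle has exactly one least element.
numCycles : {n : ℕ} → Vec (Fin n) n → ℕ
numCycles {n} v = length (filterᵇ (isCycleMin v) (allFin n))

-- μ_{n,s} = E[N_n^s] = (1/n!) Σ_π (#cycles π)^s  (uniform measure P(Π=π)=1/n!).
μ : ℕ → ℕ → ℚ
μ n s = (+ sum (map (λ v → numCycles v ^ s) (perms n))) / (n !)
  where instance _ = n !≢0

sumℚ : List ℚ → ℚ
sumℚ = foldr _+_ 0ℚ

range1 : ℕ → List ℕ
range1 m = map suc (upTo m)

-- Inserting a new top element into a permutation σ of n points, either as a fixed point or right
-- after one of the n points, is a bijection Sₙ × {0,…,n} → Sₙ₊₁; the first choice adds a cycle, the
-- other n keep the number of cycles N(σ). So for the power sums P(n,s) = Σ_σ N(σ)^s, expanding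
-- (N + 1)^s by the binomial theorem, P(n+1,s) = Σ_r C(s,r) P(n,r) + n P(n,s); dividing by n! gives
-- (n+1) μ(n+1,s) = n μ(n,s) + Σ_r C(s,r) μ(n,r). Telescoping, n μ(n,s) = Σ_{j<n} Σ_{r≤s} C(s,r) μ(j,r),
-- where the terms r = 0 add up to n (as μ(j,0) = 1) and the terms j = 0, r ≥ 1 vanish.

module Submission where

module CyclePowerSums where

  open import Defs
  import Algebra.Properties.CommutativeSemiring.Binomial as Binomial
  import Algebra.Properties.Semiring.Exp as SemiringExp
  import Algebra.Properties.Semiring.Mult as SemiringMult
  import Algebra.Properties.Semiring.Sum as SemiringSum
  open import Data.Bool using (Bool; true; false; T; not; _∨_; if_then_else_)
  open import Data.Bool.Properties using (T?)
  open import Data.Fin using (Fin; zero; suc; toℕ; fromℕ; inject₁; lower₁; punchOut) renaming (_≟_ to _≟ᶠ_)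
  open import Data.Fin.Properties
    using (any?; pigeonhole; <⇒≢; punchOut-injective; inject₁-injective; inject₁-lower₁; fromℕ≢inject₁;
           toℕ-injective; toℕ-fromℕ; toℕ-inject₁; toℕ<n; toℕ≤pred[n])
  open import Data.Fin.Relation.Unary.Top using (View; view; ‵fromℕ; ‵inject₁; view-fromℕ; view-inject₁)
  open import Data.List using (List; []; _∷_; map; concatMap; cartesianProductWith; _++_; allFin; upTo; filterᵇ; length)
  import Data.List as List
  open import Data.List.Membership.Propositional using (_∈_)
  open import Data.List.Membership.Propositional.Properties
    using (∈-allFin; ∈-upTo⁺; ∈-lookup; ∈-map⁺; ∈-map⁻; ∈-cartesianProductWith⁺; ∈-cartesianProductWith⁻;
           ∈-filter⁺; ∈-filter⁻)
  open import Data.List.Membership.Propositional.Properties.WithK using (unique∧set⇒bag)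
  open import Data.List.Properties using (map-++; map-∘)
  open import Data.List.Relation.Binary.BagAndSetEquality using (∼bag⇒↭)
  open import Data.List.Relation.Binary.Permutation.Propositional using (_↭_)
  import Data.List.Relation.Binary.Permutation.Propositional.Properties as Perm
  open import Data.List.Relation.Unary.All using (All)
  import Data.List.Relation.Unary.All as All
  open import Data.List.Relation.Unary.All.Properties using (all⁺; all⁻)
  open import Data.List.Relation.Unary.AllPairs using ([]; _∷_)
  open import Data.List.Relation.Unary.Any using (here; there)
  open import Data.List.Relation.Unary.Unique.Propositional using (Unique)
  import Data.List.Relation.Unary.Unique.Propositional.Properties as Unique
  open import Data.Maybe using (Maybe; just; nothing; is-nothing)
  open import Data.Maybe.Properties using (just-injective)
  open import Data.Nat using (ℕ; zero; suc; _+_; _*_; _^_; _∸_; _!; _≤_; _<_; s≤s; _≤ᵇ_)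
  open import Data.Nat.Combinatorics using (_C_)
  open import Data.Nat.DivMod using (_%_; _/_; m≡m%n+[m/n]*n; m%n<n)
  open import Data.Nat.ListAction using (sum)
  open import Data.Nat.ListAction.Properties using (sum-++; sum-↭)
  open import Data.Nat.Properties
    using (+-*-semiring; +-*-commutativeSemiring; +-comm; +-identityʳ; *-identityˡ; *-identityʳ; ^-zeroˡ;
           n<1+n; m≤m+n; m≤n⇒∃[o]m+o≡n; ≤-reflexive; ≤-trans; <⇒≤; <⇒≱; ≤ᵇ⇒≤; ≤⇒≤ᵇ)
  open import Data.Product using (∃; _×_; _,_; proj₁; proj₂)
  open import Data.Sum using (_⊎_; inj₁; inj₂)
  open import Data.Vec using (Vec; lookup) renaming ([] to []ᵛ; _∷_ to _∷ᵛ_)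
  import Data.Vec as Vec
  open import Data.Vec.Properties using (∷-injective; tabulate∘lookup; tabulate-cong; lookup∘tabulate)
  open import Function using (_∘_; id)
  open import Function.Bundles using (Equivalence; mk⇔; _⇔_)
  open import Function.Definitions using (Injective)
  open import Function.Properties.Equivalence using (⇔-setoid)
  open import Level using (0ℓ)
  open import Relation.Binary.PropositionalEquality
  import Relation.Binary.Reasoning.Setoid as SetoidReasoning
  open import Relation.Nullary using (yes; no; contradiction)
  open import Relation.Nullary.Decidable using (⌊_⌋; toWitness; fromWitness; toWitnessFalse)

  module ℕ∑ = SemiringSum +-*-semiring

  -- Permutations as injective vectors

  IsPermutation : {n : ℕ} → Vec (Fin n) n → Set
  IsPermutation v = Injective _≡_ _≡_ (lookup v)

  vec-ext : ∀ {A : Set} {n} {v w : Vec A n} → (∀ i → lookup v i ≡ lookup w i) → v ≡ w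
  vec-ext {v = v} {w} v≗w = trans (sym (tabulate∘lookup v)) (trans (tabulate-cong v≗w) (tabulate∘lookup w))

  separatedᵇ : ∀ {n} → Vec (Fin n) n → Fin n → Fin n → Bool
  separatedᵇ v i j = not ⌊ lookup v i ≟ᶠ lookup v j ⌋ ∨ ⌊ i ≟ᶠ j ⌋

  separatedᵇ⇒ : ∀ {n} (v : Vec (Fin n) n) i j → T (separatedᵇ v i j) → lookup v i ≡ lookup v j → i ≡ j
  separatedᵇ⇒ v i j sep vi≡vj with lookup v i ≟ᶠ lookup v j | i ≟ᶠ j
  ... | _        | yes i≡j = i≡j
  ... | no vi≢vj | no _    = contradiction vi≡vj vi≢vj

  separatedᵇ⇐ : ∀ {n} (v : Vec (Fin n) n) i j → (lookup v i ≡ lookup v j → i ≡ j) → T (separatedᵇ v i j)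
  separatedᵇ⇐ v i j inj with lookup v i ≟ᶠ lookup v j | i ≟ᶠ j
  ... | no _        | _       = _
  ... | yes _       | yes _   = _
  ... | yes vi≡vj   | no i≢j  = i≢j (inj vi≡vj)

  isPerm⇒IsPermutation : ∀ {n} (v : Vec (Fin n) n) → T (isPerm v) → IsPermutation v
  isPerm⇒IsPermutation {n} v isP {i} {j} = separatedᵇ⇒ v i j (All.lookup (row i) (∈-allFin j))
    where
    row : ∀ i → All (T ∘ separatedᵇ v i) (allFin n)
    rows : All (λ i → T (all (separatedᵇ v i) (allFin n))) (allFin n)
    rows = all⁺ (λ i → all (separatedᵇ v i) (allFin n)) (allFin n) isP
    row i = all⁺ (separatedᵇ v i) (allFin n) (All.lookup rows (∈-allFin i))

  IsPermutation⇒isPerm : ∀ {n} (v : Vec (Fin n) n) → IsPermutation v → T (isPerm v)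
  IsPermutation⇒isPerm {n} v inj = all⁻ (λ i → all (separatedᵇ v i) (allFin n)) {xs = allFin n} (All.tabulate λ {i} _ → row i)
    where
    row : ∀ i → T (all (separatedᵇ v i) (allFin n))
    row i = all⁻ (separatedᵇ v i) {xs = allFin n} (All.tabulate λ {j} _ → separatedᵇ⇐ v i j inj)

  allVecs-suc : ∀ m k → allVecs (suc m) k ≡ cartesianProductWith _∷ᵛ_ (allFin k) (allVecs m k)
  allVecs-suc m k = go (allFin k)
    where
    go : ∀ xs → concatMap (λ x → map (x ∷ᵛ_) (allVecs m k)) xs ≡ cartesianProductWith _∷ᵛ_ xs (allVecs m k)
    go []       = refl
    go (x ∷ xs) = cong (map (x ∷ᵛ_) (allVecs m k) ++_) (go xs)

  ∈-allVecs : ∀ {m k} (v : Vec (Fin k) m) → v ∈ allVecs m k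
  ∈-allVecs []ᵛ = here refl
  ∈-allVecs {suc m} {k} (x ∷ᵛ v) rewrite allVecs-suc m k =
    ∈-cartesianProductWith⁺ _∷ᵛ_ (∈-allFin x) (∈-allVecs v)

  allVecs-unique : ∀ m k → Unique (allVecs m k)
  allVecs-unique zero    k = All.[] ∷ []
  allVecs-unique (suc m) k rewrite allVecs-suc m k =
    Unique.cartesianProductWith⁺ _∷ᵛ_ ∷-injective (Unique.allFin⁺ k) (allVecs-unique m k)

  perms-unique : ∀ n → Unique (perms n)
  perms-unique n = Unique.filter⁺ (T? ∘ isPerm) (allVecs-unique n n)

  ∈-perms⁺ : ∀ {n} {v : Vec (Fin n) n} → IsPermutation v → v ∈ perms n
  ∈-perms⁺ {v = v} v-inj = ∈-filter⁺ (T? ∘ isPerm) (∈-allVecs v) (IsPermutation⇒isPerm v v-inj)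

  ∈-perms⁻ : ∀ {n} {v : Vec (Fin n) n} → v ∈ perms n → IsPermutation v
  ∈-perms⁻ {n} {v} v∈ = isPerm⇒IsPermutation v (proj₂ (∈-filter⁻ (T? ∘ isPerm) {xs = allVecs n n} v∈))

  -- Inserting a new top element

  -- extend σ nothing makes the new top element a fixed point; extend σ (just a) inserts it into the
  -- cycle of a, right after a.
  extendAt : ∀ {n} → (Fin n → Fin n) → Maybe (Fin n) → {i : Fin (suc n)} → View i → Fin (suc n)
  extendAt f nothing  ‵fromℕ        = fromℕ _
  extendAt f nothing  (‵inject₁ j)  = inject₁ (f j)
  extendAt f (just a) ‵fromℕ        = inject₁ (f a)
  extendAt f (just a) (‵inject₁ j) with j ≟ᶠ a
  ... | yes _ = fromℕ _
  ... | no  _ = inject₁ (f j)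

  extend : ∀ {n} → Vec (Fin n) n → Maybe (Fin n) → Vec (Fin (suc n)) (suc n)
  extend σ o = Vec.tabulate (λ i → extendAt (lookup σ) o (view i))

  -- Uniformly in o, extend σ o sends slot o j to σ j and spare o to the top element, and slot o
  -- enumerates the complement of spare o.
  spare : ∀ {n} → Maybe (Fin n) → Fin (suc n)
  spare nothing  = fromℕ _
  spare (just a) = inject₁ a

  slot : ∀ {n} → Maybe (Fin n) → Fin n → Fin (suc n)
  slot nothing  j = inject₁ j
  slot (just a) j with j ≟ᶠ a
  ... | yes _ = fromℕ _
  ... | no  _ = inject₁ j

  spare-injective : ∀ {n} → Injective {A = Maybe (Fin n)} _≡_ _≡_ spare
  spare-injective {x = nothing} {nothing} _  = refl
  spare-injective {x = nothing} {just b}  eq = contradiction eq fromℕ≢inject₁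
  spare-injective {x = just a}  {nothing} eq = contradiction (sym eq) fromℕ≢inject₁
  spare-injective {x = just a}  {just b}  eq = cong just (inject₁-injective eq)

  slot-injective : ∀ {n} (o : Maybe (Fin n)) → Injective _≡_ _≡_ (slot o)
  slot-injective nothing  eq = inject₁-injective eq
  slot-injective (just a) {j} {k} eq with j ≟ᶠ a | k ≟ᶠ a
  ... | yes j≡a | yes k≡a = trans j≡a (sym k≡a)
  ... | yes _   | no  _   = contradiction eq fromℕ≢inject₁
  ... | no  _   | yes _   = contradiction (sym eq) fromℕ≢inject₁
  ... | no  _   | no  _   = inject₁-injective eq

  slot≢spare : ∀ {n} (o : Maybe (Fin n)) j → slot o j ≢ spare o
  slot≢spare nothing  j eq = fromℕ≢inject₁ (sym eq)
  slot≢spare (just a) j eq with j ≟ᶠ a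
  ... | yes _   = fromℕ≢inject₁ eq
  ... | no  j≢a = j≢a (inject₁-injective eq)

  slot-just-self : ∀ {n} (a : Fin n) → slot (just a) a ≡ fromℕ n
  slot-just-self a with a ≟ᶠ a
  ... | yes _   = refl
  ... | no  a≢a = contradiction refl a≢a

  slot-just-other : ∀ {n} (a : Fin n) {j} → j ≢ a → slot (just a) j ≡ inject₁ j
  slot-just-other a {j} j≢a with j ≟ᶠ a
  ... | yes j≡a = contradiction j≡a j≢a
  ... | no  _   = refl

  spare-or-slot : ∀ {n} (o : Maybe (Fin n)) i → i ≡ spare o ⊎ ∃ λ j → i ≡ slot o j
  spare-or-slot nothing  i with view i
  ... | ‵fromℕ     = inj₁ refl
  ... | ‵inject₁ j = inj₂ (j , refl)
  spare-or-slot (just a) i with view i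
  ... | ‵fromℕ     = inj₂ (a , sym (slot-just-self a))
  ... | ‵inject₁ j with j ≟ᶠ a
  ...   | yes refl = inj₁ refl
  ...   | no  j≢a  = inj₂ (j , sym (slot-just-other a j≢a))

  module _ {n : ℕ} (σ : Vec (Fin n) n) where

    private
      extend-lookup : ∀ o i → lookup (extend σ o) i ≡ extendAt (lookup σ) o (view i)
      extend-lookup o i = lookup∘tabulate (λ i → extendAt (lookup σ) o (view i)) i

    extend-nothing-top : lookup (extend σ nothing) (fromℕ n) ≡ fromℕ n
    extend-nothing-top rewrite extend-lookup nothing (fromℕ n) | view-fromℕ n = refl

    extend-nothing-inject₁ : ∀ j → lookup (extend σ nothing) (inject₁ j) ≡ inject₁ (lookup σ j)
    extend-nothing-inject₁ j rewrite extend-lookup nothing (inject₁ j) | view-inject₁ j = refl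

    extend-just-top : ∀ a → lookup (extend σ (just a)) (fromℕ n) ≡ inject₁ (lookup σ a)
    extend-just-top a rewrite extend-lookup (just a) (fromℕ n) | view-fromℕ n = refl

    extend-just-self : ∀ a → lookup (extend σ (just a)) (inject₁ a) ≡ fromℕ n
    extend-just-self a rewrite extend-lookup (just a) (inject₁ a) | view-inject₁ a with a ≟ᶠ a
    ... | yes _   = refl
    ... | no  a≢a = contradiction refl a≢a

    extend-just-other : ∀ a {j} → j ≢ a → lookup (extend σ (just a)) (inject₁ j) ≡ inject₁ (lookup σ j)
    extend-just-other a {j} j≢a rewrite extend-lookup (just a) (inject₁ j) | view-inject₁ j with j ≟ᶠ a
    ... | yes j≡a = contradiction j≡a j≢a
    ... | no  _   = refl

    extend-slot : ∀ o j → lookup (extend σ o) (slot o j) ≡ inject₁ (lookup σ j)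
    extend-slot nothing  j = extend-nothing-inject₁ j
    extend-slot (just a) j with j ≟ᶠ a
    ... | yes refl = extend-just-top a
    ... | no  j≢a  = extend-just-other a j≢a

    extend-spare : ∀ o → lookup (extend σ o) (spare o) ≡ fromℕ n
    extend-spare nothing  = extend-nothing-top
    extend-spare (just a) = extend-just-self a

  extend-injective : ∀ {n} {σ σ′ : Vec (Fin n) n} {o o′} → extend σ o ≡ extend σ′ o′ → σ ≡ σ′ × o ≡ o′
  extend-injective {n} {σ} {σ′} {o} {o′} π≡π′ with spare-or-slot o (spare o′)
  ... | inj₁ spares≡ with refl ← spare-injective {x = o′} {y = o} spares≡ = vec-ext σ≗σ′ , refl
    where
    σ≗σ′ : ∀ j → lookup σ j ≡ lookup σ′ j
    σ≗σ′ j = inject₁-injective (begin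
      inject₁ (lookup σ j)            ≡⟨ extend-slot σ o j ⟨
      lookup (extend σ o) (slot o j)  ≡⟨ cong (λ π → lookup π (slot o j)) π≡π′ ⟩
      lookup (extend σ′ o) (slot o j) ≡⟨ extend-slot σ′ o j ⟩
      inject₁ (lookup σ′ j)           ∎)
      where open ≡-Reasoning
  ... | inj₂ (j , spare≡slot) = contradiction (begin
      fromℕ n                          ≡⟨ extend-spare σ′ o′ ⟨
      lookup (extend σ′ o′) (spare o′) ≡⟨ cong (λ π → lookup π (spare o′)) π≡π′ ⟨
      lookup (extend σ o) (spare o′)   ≡⟨ cong (lookup (extend σ o)) spare≡slot ⟩
      lookup (extend σ o) (slot o j)   ≡⟨ extend-slot σ o j ⟩
      inject₁ (lookup σ j)             ∎) fromℕ≢inject₁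
    where open ≡-Reasoning

  module _ {n : ℕ} (σ : Vec (Fin n) n) (o : Maybe (Fin n)) where

    extend-preserves-IsPermutation : IsPermutation σ → IsPermutation (extend σ o)
    extend-preserves-IsPermutation σ-inj {i} {k} πi≡πk with spare-or-slot o i | spare-or-slot o k
    ... | inj₁ refl       | inj₁ refl       = refl
    ... | inj₁ refl       | inj₂ (j , refl) =
      contradiction (trans (sym (extend-spare σ o)) (trans πi≡πk (extend-slot σ o j))) fromℕ≢inject₁
    ... | inj₂ (j , refl) | inj₁ refl       =
      contradiction (trans (sym (extend-spare σ o)) (trans (sym πi≡πk) (extend-slot σ o j))) fromℕ≢inject₁
    ... | inj₂ (j , refl) | inj₂ (l , refl) =
      cong (slot o) (σ-inj (inject₁-injective (trans (sym (extend-slot σ o j)) (trans πi≡πk (extend-slot σ o l)))))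

    extend-reflects-IsPermutation : IsPermutation (extend σ o) → IsPermutation σ
    extend-reflects-IsPermutation π-inj {j} {l} σj≡σl =
      slot-injective o (π-inj (trans (extend-slot σ o j) (trans (cong inject₁ σj≡σl) (sym (extend-slot σ o l)))))

  injective⇒surjective : ∀ {m} {f : Fin m → Fin m} → Injective _≡_ _≡_ f → ∀ y → ∃ λ x → f x ≡ y
  injective⇒surjective {suc m} {f} f-inj y with any? (λ x → f x ≟ᶠ y)
  ... | yes hit  = hit
  ... | no  miss =
    let i , j , i<j , collide = pigeonhole (n<1+n m) (λ x → punchOut (y≢f x))
    in contradiction (f-inj (punchOut-injective (y≢f i) (y≢f j) collide)) (<⇒≢ i<j)
    where
    y≢f : ∀ x → y ≢ f x
    y≢f x y≡fx = miss (x , sym y≡fx)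

  extend-surjective : ∀ {n} (π : Vec (Fin (suc n)) (suc n)) → IsPermutation π →
                      ∃ λ σ → ∃ λ o → extend σ o ≡ π
  extend-surjective {n} π π-inj = σ , o , vec-ext agree
    where
    spare-preimage : ∃ λ o → lookup π (spare o) ≡ fromℕ n
    spare-preimage with x , πx≡top ← injective⇒surjective π-inj (fromℕ n) | view x
    ... | ‵fromℕ     = nothing , πx≡top
    ... | ‵inject₁ a = just a , πx≡top

    o : Maybe (Fin n)
    o = proj₁ spare-preimage

    π-slot≢top : ∀ j → n ≢ toℕ (lookup π (slot o j))
    π-slot≢top j n≡πj = slot≢spare o j (π-inj (trans πj≡top (sym (proj₂ spare-preimage))))
      where
      πj≡top : lookup π (slot o j) ≡ fromℕ n
      πj≡top = toℕ-injective (trans (sym n≡πj) (sym (toℕ-fromℕ n)))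

    σ : Vec (Fin n) n
    σ = Vec.tabulate λ j → lower₁ (lookup π (slot o j)) (π-slot≢top j)

    agree : ∀ i → lookup (extend σ o) i ≡ lookup π i
    agree i with spare-or-slot o i
    ... | inj₁ refl       = trans (extend-spare σ o) (sym (proj₂ spare-preimage))
    ... | inj₂ (j , refl) = begin
      lookup (extend σ o) (slot o j)                        ≡⟨ extend-slot σ o j ⟩
      inject₁ (lookup σ j)                                  ≡⟨ cong inject₁ (lookup∘tabulate _ j) ⟩
      inject₁ (lower₁ (lookup π (slot o j)) (π-slot≢top j)) ≡⟨ inject₁-lower₁ _ (π-slot≢top j) ⟩
      lookup π (slot o j)                                   ∎
      where open ≡-Reasoning

  options : ∀ n → List (Maybe (Fin n))
  options n = nothing ∷ map just (allFin n)

  ∈-options : ∀ {n} (o : Maybe (Fin n)) → o ∈ options n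
  ∈-options nothing  = here refl
  ∈-options (just a) = there (∈-map⁺ just (∈-allFin a))

  options-unique : ∀ n → Unique (options n)
  options-unique n = All.tabulate nothing∉ ∷ Unique.map⁺ just-injective (Unique.allFin⁺ n)
    where
    nothing∉ : ∀ {o} → o ∈ map just (allFin n) → nothing ≢ o
    nothing∉ o∈ refl with _ , _ , () ← ∈-map⁻ just o∈

  perms-suc↭ : ∀ n → perms (suc n) ↭ cartesianProductWith extend (perms n) (options n)
  perms-suc↭ n = ∼bag⇒↭ (unique∧set⇒bag (perms-unique (suc n))
    (Unique.cartesianProductWith⁺ extend extend-injective (perms-unique n) (options-unique n))
    (mk⇔ split join))
    where
    split : ∀ {π} → π ∈ perms (suc n) → π ∈ cartesianProductWith extend (perms n) (options n)
    -- Matching σ⁺≡π against refl instead of using subst makes Agda normalise perms (suc n): very slow.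
    split {π} π∈ =
      let σ , o , σ⁺≡π = extend-surjective π π-perm
          σ-perm = extend-reflects-IsPermutation σ o (subst IsPermutation (sym σ⁺≡π) π-perm)
      in subst (_∈ _) σ⁺≡π (∈-cartesianProductWith⁺ extend (∈-perms⁺ {v = σ} σ-perm) (∈-options o))
      where
      π-perm : IsPermutation π
      π-perm = ∈-perms⁻ π∈
    join : ∀ {π} → π ∈ cartesianProductWith extend (perms n) (options n) → π ∈ perms (suc n)
    join {π} π∈ =
      let σ , o , σ∈ , _ , π≡σ⁺ = ∈-cartesianProductWith⁻ extend (perms n) (options n) π∈
      in subst (_∈ _) (sym π≡σ⁺) (∈-perms⁺ (extend-preserves-IsPermutation σ o (∈-perms⁻ σ∈)))

  sum-cartesianProductWith : ∀ {A B C : Set} (f : A → B → C) (g : C → ℕ) xs ys →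
    sum (map g (cartesianProductWith f xs ys)) ≡ sum (map (λ x → sum (map (λ y → g (f x y)) ys)) xs)
  sum-cartesianProductWith f g []       ys = refl
  sum-cartesianProductWith f g (x ∷ xs) ys = begin
    sum (map g (map (f x) ys ++ cartesianProductWith f xs ys))
      ≡⟨ cong sum (map-++ g (map (f x) ys) _) ⟩
    sum (map g (map (f x) ys) ++ map g (cartesianProductWith f xs ys))
      ≡⟨ sum-++ (map g (map (f x) ys)) _ ⟩
    sum (map g (map (f x) ys)) + sum (map g (cartesianProductWith f xs ys))
      ≡⟨ cong₂ _+_ (cong sum (sym (map-∘ ys))) (sum-cartesianProductWith f g xs ys) ⟩
    sum (map (g ∘ f x) ys) + sum (map (λ x → sum (map (λ y → g (f x y)) ys)) xs) ∎
    where open ≡-Reasoning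

  sum-perms-suc : ∀ n (g : Vec (Fin (suc n)) (suc n) → ℕ) →
    sum (map g (perms (suc n))) ≡ sum (map (λ σ → sum (map (λ o → g (extend σ o)) (options n))) (perms n))
  sum-perms-suc n g = trans (sum-↭ (Perm.map⁺ g (perms-suc↭ n))) (sum-cartesianProductWith extend g (perms n) (options n))


  -- Cycles and their least elements

  iter-+ : ∀ {A : Set} (f : A → A) a b x → iter f (a + b) x ≡ iter f a (iter f b x)
  iter-+ f zero    b x = refl
  iter-+ f (suc a) b x = cong f (iter-+ f a b x)

  iter-injective : ∀ {A : Set} {f : A → A} → Injective _≡_ _≡_ f → ∀ a → Injective _≡_ _≡_ (iter f a)
  iter-injective f-inj zero    eq = eq
  iter-injective f-inj (suc a) eq = iter-injective f-inj a (f-inj eq)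

  iter-period : ∀ {A : Set} (f : A → A) {p x} → iter f p x ≡ x → ∀ q → iter f (q * p) x ≡ x
  iter-period f         fᵖx≡x zero    = refl
  iter-period f {p} {x} fᵖx≡x (suc q) =
    trans (iter-+ f p (q * p) x) (trans (cong (iter f p) (iter-period f fᵖx≡x q)) fᵖx≡x)


  -- Two of the n + 1 points x, f x, …, fⁿ x coincide; injectivity makes x periodic with period ≤ n.
  iter-bounded : ∀ {n} {f : Fin n → Fin n} → Injective _≡_ _≡_ f →
                 ∀ k x → ∃ λ k′ → k′ < suc n × iter f k x ≡ iter f k′ x
  iter-bounded {n} {f} f-inj k x
    with i , j , i<j , fⁱx≡fʲx ← pigeonhole (n<1+n n) (λ t → iter f (toℕ t) x)
    with d , i+1+d≡j ← m≤n⇒∃[o]m+o≡n i<j =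
    k % p , s≤s (≤-trans (<⇒≤ (m%n<n k p)) p≤n) , periodic
    where
    p : ℕ
    p = suc d
    j≡p+i : toℕ j ≡ p + toℕ i
    j≡p+i = trans (sym i+1+d≡j) (cong suc (+-comm (toℕ i) d))
    p≤n : p ≤ n
    p≤n = ≤-trans (m≤m+n p (toℕ i)) (subst (_≤ n) j≡p+i (toℕ≤pred[n] j))
    fᵖx≡x : iter f p x ≡ x
    fᵖx≡x = iter-injective f-inj (toℕ i) (begin
      iter f (toℕ i) (iter f p x) ≡⟨ iter-+ f (toℕ i) p x ⟨
      iter f (toℕ i + p) x        ≡⟨ cong (λ m → iter f m x) (trans (+-comm (toℕ i) p) (sym j≡p+i)) ⟩
      iter f (toℕ j) x            ≡⟨ fⁱx≡fʲx ⟨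
      iter f (toℕ i) x            ∎)
      where open ≡-Reasoning
    periodic : iter f k x ≡ iter f (k % p) x
    periodic = begin
      iter f k x                            ≡⟨ cong (λ m → iter f m x) (m≡m%n+[m/n]*n k p) ⟩
      iter f (k % p + k / p * p) x          ≡⟨ iter-+ f (k % p) (k / p * p) x ⟩
      iter f (k % p) (iter f (k / p * p) x) ≡⟨ cong (iter f (k % p)) (iter-period f fᵖx≡x (k / p)) ⟩
      iter f (k % p) x                      ∎
      where open ≡-Reasoning

  LeastInOrbit : ∀ {n} → (Fin n → Fin n) → Fin n → Set
  LeastInOrbit f i = ∀ k → toℕ i ≤ toℕ (iter f k i)

  module _ {n : ℕ} (v : Vec (Fin n) n) (i : Fin n) where

    private
      cmpᵇ : ℕ → Bool
      cmpᵇ k = toℕ i ≤ᵇ toℕ (iter (lookup v) k i)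

    -- isCycleMin only inspects the first n + 1 iterates; by iter-bounded these are all of them.
    isCycleMin⇒LeastInOrbit : IsPermutation v → T (isCycleMin v i) → LeastInOrbit (lookup v) i
    isCycleMin⇒LeastInOrbit v-perm isMin k with k′ , k′≤n , fᵏi≡fᵏ′i ← iter-bounded v-perm k i =
      subst (λ y → toℕ i ≤ toℕ y) (sym fᵏi≡fᵏ′i)
            (≤ᵇ⇒≤ _ _ (All.lookup (all⁺ cmpᵇ (upTo (suc n)) isMin) (∈-upTo⁺ k′≤n)))

    LeastInOrbit⇒isCycleMin : LeastInOrbit (lookup v) i → T (isCycleMin v i)
    LeastInOrbit⇒isCycleMin least = all⁻ cmpᵇ {xs = upTo (suc n)} (All.tabulate λ {k} _ → ≤⇒≤ᵇ (least k))

  LeastInOrbit-inject₁ : ∀ {n} {f : Fin n → Fin n} {g : Fin (suc n) → Fin (suc n)} {x} →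
    (∀ k → iter g k (inject₁ x) ≡ fromℕ n ⊎ ∃ λ m → iter g k (inject₁ x) ≡ inject₁ (iter f m x)) →
    (∀ m → ∃ λ k → iter g k (inject₁ x) ≡ inject₁ (iter f m x)) →
    LeastInOrbit g (inject₁ x) ⇔ LeastInOrbit f x
  LeastInOrbit-inject₁ {n} {f} {g} {x} g⊆f f⊆g = mk⇔ restrict extend-least
    where
    toℕ-orbit : ∀ k m → iter g k (inject₁ x) ≡ inject₁ (iter f m x) → toℕ (iter g k (inject₁ x)) ≡ toℕ (iter f m x)
    toℕ-orbit k m eq = trans (cong toℕ eq) (toℕ-inject₁ _)

    restrict : LeastInOrbit g (inject₁ x) → LeastInOrbit f x
    restrict least m with k , eq ← f⊆g m =
      subst₂ _≤_ (toℕ-inject₁ x) (toℕ-orbit k m eq) (least k)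

    extend-least : LeastInOrbit f x → LeastInOrbit g (inject₁ x)
    extend-least least k with g⊆f k
    ... | inj₁ top      =
      subst₂ _≤_ (sym (toℕ-inject₁ x)) (trans (sym (toℕ-fromℕ n)) (cong toℕ (sym top))) (<⇒≤ (toℕ<n x))
    ... | inj₂ (m , eq) = subst₂ _≤_ (sym (toℕ-inject₁ x)) (sym (toℕ-orbit k m eq)) (least m)

  module _ {n : ℕ} (σ : Vec (Fin n) n) where

    private
      f : Fin n → Fin n
      f = lookup σ

      g : Maybe (Fin n) → Fin (suc n) → Fin (suc n)
      g o = lookup (extend σ o)

    iter-extend-nothing-inject₁ : ∀ k x → iter (g nothing) k (inject₁ x) ≡ inject₁ (iter f k x)
    iter-extend-nothing-inject₁ zero    x = refl
    iter-extend-nothing-inject₁ (suc k) x =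
      trans (cong (g nothing) (iter-extend-nothing-inject₁ k x)) (extend-nothing-inject₁ σ _)

    iter-extend-nothing-top : ∀ k → iter (g nothing) k (fromℕ n) ≡ fromℕ n
    iter-extend-nothing-top zero    = refl
    iter-extend-nothing-top (suc k) = trans (cong (g nothing) (iter-extend-nothing-top k)) (extend-nothing-top σ)

    -- The orbit of inject₁ x under the extension is that of x, with the top element inserted right after a.
    iter-extend-just⊆ : ∀ a k x → ∃ λ m →
      iter (g (just a)) k (inject₁ x) ≡ inject₁ (iter f m x) ⊎ (iter (g (just a)) k (inject₁ x) ≡ fromℕ n × iter f m x ≡ a)
    iter-extend-just⊆ a zero    x = 0 , inj₁ refl
    iter-extend-just⊆ a (suc k) x with iter-extend-just⊆ a k x
    ... | m , inj₂ (at-top , fᵐx≡a) =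
      suc m , inj₁ (trans (cong (g (just a)) at-top) (trans (extend-just-top σ a) (cong (inject₁ ∘ f) (sym fᵐx≡a))))
    ... | m , inj₁ eq with iter f m x ≟ᶠ a
    ...   | yes refl = m , inj₂ (trans (cong (g (just a)) eq) (extend-just-self σ a) , refl)
    ...   | no  fᵐx≢a = suc m , inj₁ (trans (cong (g (just a)) eq) (extend-just-other σ a fᵐx≢a))

    iter-extend-just⊇ : ∀ a m x → ∃ λ k → iter (g (just a)) k (inject₁ x) ≡ inject₁ (iter f m x)
    iter-extend-just⊇ a zero    x = 0 , refl
    iter-extend-just⊇ a (suc m) x with k , eq ← iter-extend-just⊇ a m x | iter f m x ≟ᶠ a
    ... | yes refl = suc (suc k) ,
      trans (cong (g (just a) ∘ g (just a)) eq) (trans (cong (g (just a)) (extend-just-self σ a)) (extend-just-top σ a))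
    ... | no fᵐx≢a = suc k , trans (cong (g (just a)) eq) (extend-just-other σ a fᵐx≢a)

  T-injective : ∀ {b c} → T b ⇔ T c → b ≡ c
  T-injective {false} {false} _   = refl
  T-injective {false} {true}  b⇔c = contradiction (Equivalence.from b⇔c _) id
  T-injective {true}  {false} b⇔c = contradiction (Equivalence.to b⇔c _) id
  T-injective {true}  {true}  _   = refl

  isCycleMin⇔LeastInOrbit : ∀ {n} (v : Vec (Fin n) n) → IsPermutation v → ∀ i → T (isCycleMin v i) ⇔ LeastInOrbit (lookup v) i
  isCycleMin⇔LeastInOrbit v v-perm i = mk⇔ (isCycleMin⇒LeastInOrbit v i v-perm) (LeastInOrbit⇒isCycleMin v i)

  module _ {n : ℕ} (σ : Vec (Fin n) n) (σ-perm : IsPermutation σ) where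

    isCycleMin-extend-inject₁ : ∀ o x → isCycleMin (extend σ o) (inject₁ x) ≡ isCycleMin σ x
    isCycleMin-extend-inject₁ o x = T-injective (begin
      T (isCycleMin (extend σ o) (inject₁ x))
        ≈⟨ isCycleMin⇔LeastInOrbit (extend σ o) (extend-preserves-IsPermutation σ o σ-perm) (inject₁ x) ⟩
      LeastInOrbit (lookup (extend σ o)) (inject₁ x) ≈⟨ LeastInOrbit-inject₁ (orbit⊆ o) (orbit⊇ o) ⟩
      LeastInOrbit (lookup σ) x                      ≈⟨ isCycleMin⇔LeastInOrbit σ σ-perm x ⟨
      T (isCycleMin σ x)                             ∎)
      where
      open SetoidReasoning (⇔-setoid 0ℓ)
      orbit⊆ : ∀ o k → iter (lookup (extend σ o)) k (inject₁ x) ≡ fromℕ n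
                       ⊎ ∃ λ m → iter (lookup (extend σ o)) k (inject₁ x) ≡ inject₁ (iter (lookup σ) m x)
      orbit⊆ nothing  k = inj₂ (k , iter-extend-nothing-inject₁ σ k x)
      orbit⊆ (just a) k with iter-extend-just⊆ σ a k x
      ... | m , inj₁ eq       = inj₂ (m , eq)
      ... | _ , inj₂ (top , _) = inj₁ top
      orbit⊇ : ∀ o m → ∃ λ k → iter (lookup (extend σ o)) k (inject₁ x) ≡ inject₁ (iter (lookup σ) m x)
      orbit⊇ nothing  m = m , iter-extend-nothing-inject₁ σ m x
      orbit⊇ (just a) m = iter-extend-just⊇ σ a m x

    isCycleMin-extend-top : ∀ o → isCycleMin (extend σ o) (fromℕ n) ≡ is-nothing o
    isCycleMin-extend-top nothing =
      T-injective (mk⇔ (λ _ → _) (λ _ → LeastInOrbit⇒isCycleMin (extend σ nothing) (fromℕ n) top-least))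
      where
      top-least : LeastInOrbit (lookup (extend σ nothing)) (fromℕ n)
      top-least k = ≤-reflexive (cong toℕ (sym (iter-extend-nothing-top σ k)))
    isCycleMin-extend-top (just a) = T-injective (mk⇔ (λ isMin → <⇒≱ top>πtop (least isMin 1)) λ ())
      where
      least : T (isCycleMin (extend σ (just a)) (fromℕ n)) → LeastInOrbit (lookup (extend σ (just a))) (fromℕ n)
      least = isCycleMin⇒LeastInOrbit (extend σ (just a)) (fromℕ n) (extend-preserves-IsPermutation σ (just a) σ-perm)
      top>πtop : toℕ (lookup (extend σ (just a)) (fromℕ n)) < toℕ (fromℕ n)
      top>πtop = subst₂ _<_ (trans (sym (toℕ-inject₁ _)) (cong toℕ (sym (extend-just-top σ a))))
                            (sym (toℕ-fromℕ n)) (toℕ<n (lookup σ a))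

  indicator : Bool → ℕ
  indicator b = if b then 1 else 0

  length-filterᵇ-tabulate : ∀ {A : Set} {n} (p : A → Bool) (h : Fin n → A) →
    length (filterᵇ p (List.tabulate h)) ≡ ℕ∑.sum (indicator ∘ p ∘ h)
  length-filterᵇ-tabulate {n = zero}  p h = refl
  length-filterᵇ-tabulate {n = suc n} p h with p (h zero)
  ... | true  = cong suc (length-filterᵇ-tabulate p (h ∘ suc))
  ... | false = length-filterᵇ-tabulate p (h ∘ suc)

  numCycles≡∑ : ∀ {n} (v : Vec (Fin n) n) → numCycles v ≡ ℕ∑.sum (indicator ∘ isCycleMin v)
  numCycles≡∑ v = length-filterᵇ-tabulate (isCycleMin v) id

  numCycles-extend : ∀ {n} (σ : Vec (Fin n) n) → IsPermutation σ → ∀ o →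
                     numCycles (extend σ o) ≡ numCycles σ + indicator (is-nothing o)
  numCycles-extend {n} σ σ-perm o = begin
    numCycles π                                                      ≡⟨ numCycles≡∑ π ⟩
    ℕ∑.sum (indicator ∘ isCycleMin π)                                ≡⟨ ℕ∑.sum-init-last (indicator ∘ isCycleMin π) ⟩
    ℕ∑.sum (indicator ∘ isCycleMin π ∘ inject₁) + indicator (isCycleMin π (fromℕ n))
      ≡⟨ cong₂ _+_ (ℕ∑.sum-cong-≗ (cong indicator ∘ isCycleMin-extend-inject₁ σ σ-perm o))
                   (cong indicator (isCycleMin-extend-top σ σ-perm o)) ⟩
    ℕ∑.sum (indicator ∘ isCycleMin σ) + indicator (is-nothing o)     ≡⟨ cong (_+ _) (numCycles≡∑ σ) ⟨
    numCycles σ + indicator (is-nothing o)                           ∎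
    where
    open ≡-Reasoning
    π : Vec (Fin (suc n)) (suc n)
    π = extend σ o

  -- Power sums of the number of cycles

  module ℕBinomial = Binomial +-*-commutativeSemiring
  module ℕMult = SemiringMult +-*-semiring
  module ℕExp = SemiringExp +-*-semiring

  ×≡* : ∀ m x → m ℕMult.× x ≡ m * x
  ×≡* zero    x = refl
  ×≡* (suc m) x = cong (x +_) (×≡* m x)

  ^≡^ : ∀ x m → x ℕExp.^ m ≡ x ^ m
  ^≡^ x zero    = refl
  ^≡^ x (suc m) = cong (x *_) (^≡^ x m)

  binomial : ∀ x s → (x + 1) ^ s ≡ ℕ∑.sum (λ (r : Fin (suc s)) → (s C toℕ r) * x ^ toℕ r)
  binomial x s = begin
    (x + 1) ^ s                                      ≡⟨ ^≡^ (x + 1) s ⟨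
    (x + 1) ℕExp.^ s                                 ≡⟨ ℕBinomial.theorem s x 1 ⟩
    ℕBinomial.binomialExpansion x 1 s                ≡⟨ ℕ∑.sum-cong-≗ term ⟩
    ℕ∑.sum (λ (r : Fin (suc s)) → (s C toℕ r) * x ^ toℕ r) ∎
    where
    open ≡-Reasoning
    term : ∀ r → ℕBinomial.binomialTerm x 1 s r ≡ (s C toℕ r) * x ^ toℕ r
    term r = begin
      (s C toℕ r) ℕMult.× (x ℕExp.^ toℕ r * 1 ℕExp.^ (s ∸ toℕ r)) ≡⟨ ×≡* (s C toℕ r) _ ⟩
      (s C toℕ r) * (x ℕExp.^ toℕ r * 1 ℕExp.^ (s ∸ toℕ r))
        ≡⟨ cong ((s C toℕ r) *_) (cong₂ _*_ (^≡^ x (toℕ r)) (trans (^≡^ 1 (s ∸ toℕ r)) (^-zeroˡ (s ∸ toℕ r)))) ⟩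
      (s C toℕ r) * (x ^ toℕ r * 1)  ≡⟨ cong ((s C toℕ r) *_) (*-identityʳ (x ^ toℕ r)) ⟩
      (s C toℕ r) * x ^ toℕ r        ∎

  sum-map≡∑-lookup : ∀ {A : Set} (f : A → ℕ) xs → sum (map f xs) ≡ ℕ∑.sum (f ∘ List.lookup xs)
  sum-map≡∑-lookup f []       = refl
  sum-map≡∑-lookup f (x ∷ xs) = cong (f x +_) (sum-map≡∑-lookup f xs)

  sum-map-tabulate : ∀ {A : Set} {n} (f : A → ℕ) (h : Fin n → A) → sum (map f (List.tabulate h)) ≡ ℕ∑.sum (f ∘ h)
  sum-map-tabulate {n = zero}  f h = refl
  sum-map-tabulate {n = suc n} f h = cong (f (h zero) +_) (sum-map-tabulate f (h ∘ suc))

  sum-options-extend : ∀ {n} (σ : Vec (Fin n) n) → IsPermutation σ → ∀ s →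
    sum (map (λ o → numCycles (extend σ o) ^ s) (options n)) ≡ (numCycles σ + 1) ^ s + n * numCycles σ ^ s
  sum-options-extend {n} σ σ-perm s = cong₂ _+_ (cong (_^ s) (numCycles-extend σ σ-perm nothing)) just-terms
    where
    open ≡-Reasoning
    term : Fin n → ℕ
    term a = numCycles (extend σ (just a)) ^ s
    just-terms : sum (map (λ o → numCycles (extend σ o) ^ s) (map just (allFin n))) ≡ n * numCycles σ ^ s
    just-terms = begin
      sum (map (λ o → numCycles (extend σ o) ^ s) (map just (allFin n))) ≡⟨ cong sum (map-∘ (allFin n)) ⟨
      sum (map term (allFin n))                                          ≡⟨ sum-map-tabulate term id ⟩
      ℕ∑.sum term
        ≡⟨ ℕ∑.sum-cong-≗ (λ a → cong (_^ s) (trans (numCycles-extend σ σ-perm (just a)) (+-identityʳ _))) ⟩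
      ℕ∑.sum (λ (_ : Fin n) → numCycles σ ^ s)                           ≡⟨ ℕ∑.sum-replicate n ⟩
      n ℕMult.× numCycles σ ^ s                                          ≡⟨ ×≡* n _ ⟩
      n * numCycles σ ^ s                                                ∎

  cyclePowerSum : ℕ → ℕ → ℕ
  cyclePowerSum n s = sum (map (λ v → numCycles v ^ s) (perms n))

  cyclePowerSum-suc : ∀ n s → cyclePowerSum (suc n) s ≡
    ℕ∑.sum (λ (r : Fin (suc s)) → (s C toℕ r) * cyclePowerSum n (toℕ r)) + n * cyclePowerSum n s
  cyclePowerSum-suc n s = begin
    cyclePowerSum (suc n) s
      ≡⟨ sum-perms-suc n (λ v → numCycles v ^ s) ⟩
    sum (map (λ σ → sum (map (λ o → numCycles (extend σ o) ^ s) (options n))) (perms n))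
      ≡⟨ sum-map≡∑-lookup _ (perms n) ⟩
    ∑ᵢ (λ i → sum (map (λ o → numCycles (extend (σ i) o) ^ s) (options n)))
      ≡⟨ ℕ∑.sum-cong-≗ (λ i → sum-options-extend (σ i) (∈-perms⁻ (∈-lookup i)) s) ⟩
    ∑ᵢ (λ i → (N i + 1) ^ s + n * N i ^ s)
      ≡⟨ ℕ∑.∑-distrib-+ (λ i → (N i + 1) ^ s) (λ i → n * N i ^ s) ⟩
    ∑ᵢ (λ i → (N i + 1) ^ s) + ∑ᵢ (λ i → n * N i ^ s)
      ≡⟨ cong₂ _+_ (ℕ∑.sum-cong-≗ (λ i → binomial (N i) s)) (sym (ℕ∑.*-distribˡ-sum n (λ i → N i ^ s))) ⟩
    ∑ᵢ (λ i → ∑ᵣ (λ r → (s C toℕ r) * N i ^ toℕ r)) + n * S s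
      ≡⟨ cong (_+ n * S s) (ℕ∑.∑-comm (λ i (r : Fin (suc s)) → (s C toℕ r) * N i ^ toℕ r)) ⟩
    ∑ᵣ (λ r → ∑ᵢ (λ i → (s C toℕ r) * N i ^ toℕ r)) + n * S s
      ≡⟨ cong (_+ n * S s) (ℕ∑.sum-cong-≗ {suc s} (λ r → ℕ∑.*-distribˡ-sum (s C toℕ r) (λ i → N i ^ toℕ r))) ⟨
    ∑ᵣ (λ r → (s C toℕ r) * S (toℕ r)) + n * S s
      ≡⟨ cong₂ _+_ (ℕ∑.sum-cong-≗ {suc s} (λ r → cong ((s C toℕ r) *_) (S≡ (toℕ r)))) (cong (n *_) (S≡ s)) ⟨
    ∑ᵣ (λ r → (s C toℕ r) * cyclePowerSum n (toℕ r)) + n * cyclePowerSum n s ∎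
    where
    open ≡-Reasoning
    ∑ᵢ : (Fin (length (perms n)) → ℕ) → ℕ
    ∑ᵢ = ℕ∑.sum
    ∑ᵣ : (Fin (suc s) → ℕ) → ℕ
    ∑ᵣ = ℕ∑.sum
    σ : Fin (length (perms n)) → Vec (Fin n) n
    σ = List.lookup (perms n)
    N : Fin (length (perms n)) → ℕ
    N i = numCycles (σ i)
    S : ℕ → ℕ
    S r = ∑ᵢ (λ i → N i ^ r)
    S≡ : ∀ r → cyclePowerSum n r ≡ S r
    S≡ r = sum-map≡∑-lookup (λ v → numCycles v ^ r) (perms n)

  cyclePowerSum[n,0]≡n! : ∀ n → cyclePowerSum n 0 ≡ n !
  cyclePowerSum[n,0]≡n! zero    = refl
  cyclePowerSum[n,0]≡n! (suc n) = begin
    cyclePowerSum (suc n) 0                                       ≡⟨ cyclePowerSum-suc n 0 ⟩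
    (1 * cyclePowerSum n 0 + 0) + n * cyclePowerSum n 0           ≡⟨ cong (λ m → (1 * m + 0) + n * m) (cyclePowerSum[n,0]≡n! n) ⟩
    (1 * n ! + 0) + n * n !
      ≡⟨ cong (_+ n * n !) (trans (+-identityʳ (1 * n !)) (*-identityˡ (n !))) ⟩
    suc n !                                                       ∎
    where open ≡-Reasoning

module Moments where

  open import Defs
  open CyclePowerSums using (module ℕ∑; cyclePowerSum; cyclePowerSum-suc; cyclePowerSum[n,0]≡n!)
  open import Algebra.Bundles using (Ring)
  import Algebra.Properties.Semiring.Sum as SemiringSum
  open import Data.Fin using (Fin; zero; suc; toℕ; inject₁; fromℕ)
  open import Data.Fin.Properties using (toℕ-inject₁; toℕ-fromℕ)
  import Data.Integer as ℤ
  open import Data.Integer using (+_)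
  import Data.Integer.Properties as ℤ
  open import Data.List using (map; applyUpTo)
  open import Data.List.Properties using (map-applyUpTo)
  import Data.Nat as ℕ
  open import Data.Nat using (ℕ; zero; suc; NonZero; _!)
  import Data.Nat.Properties as ℕ
  open import Data.Nat.Properties using (_!≢0)
  open import Data.Nat.Combinatorics using (_C_)
  open import Data.Nat.Tactic.RingSolver using (solve-∀)
  open import Data.Rational using (ℚ; _/_; _+_; _*_; 1ℚ; toℚᵘ)
  open import Data.Rational.Properties
    using (+-*-ring; +-comm; +-identityˡ; *-zeroˡ; *-zeroʳ; *-identityˡ;
           toℚᵘ-injective; toℚᵘ-fromℚᵘ; fromℚᵘ-cong; toℚᵘ-homo-+; toℚᵘ-homo-*)
  import Data.Rational.Unnormalised as ℚᵘ
  import Data.Rational.Unnormalised.Properties as ℚᵘ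
  open import Function using (_∘_; id)
  open import Relation.Binary.PropositionalEquality

  module ℚ∑ = SemiringSum (Ring.semiring +-*-ring)

  _/1 : ℕ → ℚ
  a /1 = (+ a) / 1

  /-cong : ∀ a b d e .{{_ : NonZero d}} .{{_ : NonZero e}} → a ℕ.* e ≡ b ℕ.* d → (+ a) / d ≡ (+ b) / e
  /-cong a b (suc d) (suc e) eq = fromℚᵘ-cong {ℚᵘ.mkℚᵘ (+ a) d} {ℚᵘ.mkℚᵘ (+ b) e}
    (ℚᵘ.*≡* (trans (sym (ℤ.pos-* a (suc e))) (trans (cong +_ eq) (ℤ.pos-* b (suc d)))))

  toℚᵘ-/ : ∀ a d .{{_ : NonZero d}} → toℚᵘ ((+ a) / d) ℚᵘ.≃ (+ a) ℚᵘ./ d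
  toℚᵘ-/ a (suc d) = toℚᵘ-fromℚᵘ (ℚᵘ.mkℚᵘ (+ a) d)

  /-*-/ : ∀ a b d e .{{_ : NonZero d}} .{{_ : NonZero e}} →
          ((+ a) / d) * ((+ b) / e) ≡ ((+ (a ℕ.* b)) / (d ℕ.* e)) {{ℕ.m*n≢0 d e}}
  /-*-/ a b d@(suc _) e@(suc _) = toℚᵘ-injective (begin
    toℚᵘ (((+ a) / d) * ((+ b) / e))            ≈⟨ toℚᵘ-homo-* ((+ a) / d) ((+ b) / e) ⟩
    toℚᵘ ((+ a) / d) ℚᵘ.* toℚᵘ ((+ b) / e)      ≈⟨ ℚᵘ.*-cong (toℚᵘ-/ a d) (toℚᵘ-/ b e) ⟩
    ((+ a) ℚᵘ./ d) ℚᵘ.* ((+ b) ℚᵘ./ e)          ≡⟨ cong (ℚᵘ._/ (d ℕ.* e)) (ℤ.pos-* a b) ⟨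
    (+ (a ℕ.* b)) ℚᵘ./ (d ℕ.* e)                ≈⟨ toℚᵘ-/ (a ℕ.* b) (d ℕ.* e) ⟨
    toℚᵘ ((+ (a ℕ.* b)) / (d ℕ.* e))            ∎)
    where open ℚᵘ.≃-Reasoning

  /-+-/ : ∀ a b d e .{{_ : NonZero d}} .{{_ : NonZero e}} →
          (+ a) / d + (+ b) / e ≡ ((+ (a ℕ.* e ℕ.+ b ℕ.* d)) / (d ℕ.* e)) {{ℕ.m*n≢0 d e}}
  /-+-/ a b d@(suc _) e@(suc _) = toℚᵘ-injective (begin
    toℚᵘ ((+ a) / d + (+ b) / e)                ≈⟨ toℚᵘ-homo-+ ((+ a) / d) ((+ b) / e) ⟩
    toℚᵘ ((+ a) / d) ℚᵘ.+ toℚᵘ ((+ b) / e)      ≈⟨ ℚᵘ.+-cong (toℚᵘ-/ a d) (toℚᵘ-/ b e) ⟩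
    ((+ a) ℚᵘ./ d) ℚᵘ.+ ((+ b) ℚᵘ./ e)          ≡⟨ cong (ℚᵘ._/ (d ℕ.* e)) numerator ⟩
    (+ (a ℕ.* e ℕ.+ b ℕ.* d)) ℚᵘ./ (d ℕ.* e)    ≈⟨ toℚᵘ-/ (a ℕ.* e ℕ.+ b ℕ.* d) (d ℕ.* e) ⟨
    toℚᵘ ((+ (a ℕ.* e ℕ.+ b ℕ.* d)) / (d ℕ.* e)) ∎)
    where
    open ℚᵘ.≃-Reasoning
    numerator : (+ a) ℤ.* (+ e) ℤ.+ (+ b) ℤ.* (+ d) ≡ + (a ℕ.* e ℕ.+ b ℕ.* d)
    numerator = trans (cong₂ ℤ._+_ (sym (ℤ.pos-* a e)) (sym (ℤ.pos-* b d))) (sym (ℤ.pos-+ (a ℕ.* e) (b ℕ.* d)))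

  /-distrib-+ : ∀ a b d .{{_ : NonZero d}} → (+ (a ℕ.+ b)) / d ≡ (+ a) / d + (+ b) / d
  /-distrib-+ a b d = trans (/-cong (a ℕ.+ b) (a ℕ.* d ℕ.+ b ℕ.* d) d (d ℕ.* d) (lemma a b d)) (sym (/-+-/ a b d d))
    where
    instance _ = ℕ.m*n≢0 d d
    lemma : ∀ a b d → (a ℕ.+ b) ℕ.* (d ℕ.* d) ≡ (a ℕ.* d ℕ.+ b ℕ.* d) ℕ.* d
    lemma = solve-∀

  /1-*-/ : ∀ c a d .{{_ : NonZero d}} → (c /1) * ((+ a) / d) ≡ (+ (c ℕ.* a)) / d
  /1-*-/ c a d = trans (/-*-/ c a 1 d) (/-cong (c ℕ.* a) (c ℕ.* a) (1 ℕ.* d) d {{ℕ.m*n≢0 1 d}} (lemma c a d))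
    where
    lemma : ∀ c a d → c ℕ.* a ℕ.* d ≡ c ℕ.* a ℕ.* (1 ℕ.* d)
    lemma = solve-∀

  /-cancelˡ : ∀ k a d .{{_ : NonZero k}} .{{_ : NonZero d}} →
              ((+ (k ℕ.* a)) / (k ℕ.* d)) {{ℕ.m*n≢0 k d}} ≡ (+ a) / d
  /-cancelˡ k a d = /-cong (k ℕ.* a) a (k ℕ.* d) d {{ℕ.m*n≢0 k d}} (lemma k a d)
    where
    lemma : ∀ k a d → k ℕ.* a ℕ.* d ≡ a ℕ.* (k ℕ.* d)
    lemma = solve-∀

  1/n*n≡1 : ∀ n .{{_ : NonZero n}} → ((+ 1) / n) * (n /1) ≡ 1ℚ
  1/n*n≡1 n = trans (/-*-/ 1 n n 1) (/-cong (1 ℕ.* n) 1 (n ℕ.* 1) 1 {{ℕ.m*n≢0 n 1}} (lemma n))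
    where
    lemma : ∀ n → 1 ℕ.* n ℕ.* 1 ≡ 1 ℕ.* (n ℕ.* 1)
    lemma = solve-∀

  /-sum : ∀ {n} (f : Fin n → ℕ) d .{{_ : NonZero d}} → (+ ℕ∑.sum f) / d ≡ ℚ∑.sum (λ i → (+ f i) / d)
  /-sum {zero}  f d = /-cong 0 0 d 1 refl
  /-sum {suc n} f d = trans (/-distrib-+ (f zero) _ d) (cong (_+_ ((+ f zero) / d)) (/-sum (f ∘ suc) d))

  ∑-1ℚ : ∀ n → ℚ∑.sum (λ (_ : Fin n) → 1ℚ) ≡ n /1
  ∑-1ℚ zero    = refl
  ∑-1ℚ (suc n) = trans (cong (_+_ 1ℚ) (∑-1ℚ n)) (sym (/-distrib-+ 1 n 1))

  sumℚ-map-applyUpTo : ∀ (f : ℕ → ℚ) g k → sumℚ (map f (applyUpTo g k)) ≡ ℚ∑.sum (λ (i : Fin k) → f (g (toℕ i)))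
  sumℚ-map-applyUpTo f g zero    = refl
  sumℚ-map-applyUpTo f g (suc k) = cong (_+_ (f (g 0))) (sumℚ-map-applyUpTo f (g ∘ suc) k)

  sumℚ-map-range1 : ∀ (f : ℕ → ℚ) k → sumℚ (map f (range1 k)) ≡ ℚ∑.sum (λ (i : Fin k) → f (suc (toℕ i)))
  sumℚ-map-range1 f k = trans (cong (sumℚ ∘ map f) (map-applyUpTo id suc k)) (sumℚ-map-applyUpTo f suc k)

  μ[n,0]≡1 : ∀ n → μ n 0 ≡ 1ℚ
  μ[n,0]≡1 n =
    trans (cong (λ m → (+ m) / (n !)) (cyclePowerSum[n,0]≡n! n)) (/-cong (n !) 1 (n !) 1 (ℕ.*-comm (n !) 1))
    where instance _ = n !≢0

  μ-suc : ∀ n s → (suc n /1) * μ (suc n) s ≡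
                  (n /1) * μ n s + ℚ∑.sum (λ (r : Fin (suc s)) → ((s C toℕ r) /1) * μ n (toℕ r))
  μ-suc n s = begin
    (suc n /1) * μ (suc n) s                             ≡⟨ /1-*-/ (suc n) (P (suc n) s) (suc n !) ⟩
    (+ (suc n ℕ.* P (suc n) s)) / (suc n !)              ≡⟨ /-cancelˡ (suc n) (P (suc n) s) (n !) ⟩
    (+ P (suc n) s) / (n !)                              ≡⟨ cong (λ m → (+ m) / (n !)) (cyclePowerSum-suc n s) ⟩
    (+ (ℕ∑.sum binomialTerm ℕ.+ n ℕ.* P n s)) / (n !)    ≡⟨ /-distrib-+ (ℕ∑.sum binomialTerm) (n ℕ.* P n s) (n !) ⟩
    (+ ℕ∑.sum binomialTerm) / (n !) + (+ (n ℕ.* P n s)) / (n !)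
      ≡⟨ cong₂ _+_ (/-sum binomialTerm (n !)) (sym (/1-*-/ n (P n s) (n !))) ⟩
    ℚ∑.sum (λ r → (+ binomialTerm r) / (n !)) + (n /1) * μ n s
      ≡⟨ cong (_+ (n /1) * μ n s) (ℚ∑.sum-cong-≗ (λ (r : Fin (suc s)) → /1-*-/ (s C toℕ r) (P n (toℕ r)) (n !))) ⟨
    ℚ∑.sum moment-term + (n /1) * μ n s                  ≡⟨ +-comm (ℚ∑.sum moment-term) ((n /1) * μ n s) ⟩
    (n /1) * μ n s + ℚ∑.sum moment-term                  ∎
    where
    open ≡-Reasoning
    instance
      _ = n !≢0
      _ = suc n !≢0
    P : ℕ → ℕ → ℕ
    P = cyclePowerSum
    binomialTerm : Fin (suc s) → ℕ
    binomialTerm r = (s C toℕ r) ℕ.* P n (toℕ r)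
    moment-term : Fin (suc s) → ℚ
    moment-term r = ((s C toℕ r) /1) * μ n (toℕ r)

  μ-telescoped : ∀ n s → (n /1) * μ n s ≡
    ℚ∑.sum (λ (j : Fin n) → ℚ∑.sum (λ (r : Fin (suc s)) → ((s C toℕ r) /1) * μ (toℕ j) (toℕ r)))
  μ-telescoped zero    s = *-zeroˡ (μ 0 s)
  μ-telescoped (suc n) s = begin
    (suc n /1) * μ (suc n) s                                 ≡⟨ μ-suc n s ⟩
    (n /1) * μ n s + row n                                   ≡⟨ cong (_+ row n) (μ-telescoped n s) ⟩
    ℚ∑.sum (λ (j : Fin n) → row (toℕ j)) + row n
      ≡⟨ cong₂ _+_ (ℚ∑.sum-cong-≗ {n} (cong row ∘ toℕ-inject₁)) (cong row (toℕ-fromℕ n)) ⟨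
    ℚ∑.sum (λ (j : Fin n) → row (toℕ (inject₁ j))) + row (toℕ (fromℕ n)) ≡⟨ ℚ∑.sum-init-last {n} (row ∘ toℕ) ⟨
    ℚ∑.sum (λ (j : Fin (suc n)) → row (toℕ j))               ∎
    where
    open ≡-Reasoning
    row : ℕ → ℚ
    row j = ℚ∑.sum (λ (r : Fin (suc s)) → ((s C toℕ r) /1) * μ j (toℕ r))

  μ-recurrence : ∀ m s → (suc m /1) * μ (suc m) s ≡
    suc m /1 + sumℚ (map (λ r → sumℚ (map (λ j → ((+ (s C r)) / 1) * μ j r) (range1 m))) (range1 s))
  μ-recurrence m s = begin
    (n /1) * μ n s                                                       ≡⟨ μ-telescoped n s ⟩
    ℚ∑.sum (λ (j : Fin n) → ℚ∑.sum (λ (r : Fin (suc s)) → T (toℕ j) (toℕ r)))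
      ≡⟨ ℚ∑.∑-comm (λ (j : Fin n) (r : Fin (suc s)) → T (toℕ j) (toℕ r)) ⟩
    ℚ∑.sum (λ (j : Fin n) → T (toℕ j) 0) + ℚ∑.sum (λ (r : Fin s) → ℚ∑.sum (λ (j : Fin n) → T (toℕ j) (suc (toℕ r))))
      ≡⟨ cong₂ _+_ (trans (ℚ∑.sum-cong-≗ T[j,0]≡1) (∑-1ℚ n)) (ℚ∑.sum-cong-≗ T[0,r+1]-vanishes) ⟩
    n /1 + ℚ∑.sum rest                                                   ≡⟨ cong (n /1 +_) rest-as-lists ⟩
    n /1 + sumℚ (map row (range1 s))                                     ∎
    where
    open ≡-Reasoning
    n : ℕ
    n = suc m
    T : ℕ → ℕ → ℚ
    T j r = ((s C r) /1) * μ j r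
    rest : Fin s → ℚ
    rest r = ℚ∑.sum (λ (j : Fin m) → T (suc (toℕ j)) (suc (toℕ r)))
    row : ℕ → ℚ
    row r = sumℚ (map (λ j → T j r) (range1 m))
    rest-as-lists : ℚ∑.sum rest ≡ sumℚ (map row (range1 s))
    rest-as-lists = sym (trans (sumℚ-map-range1 row s)
                               (ℚ∑.sum-cong-≗ {s} (λ r → sumℚ-map-range1 (λ j → T j (suc (toℕ r))) m)))
    T[j,0]≡1 : ∀ (j : Fin n) → T (toℕ j) 0 ≡ 1ℚ
    T[j,0]≡1 j = trans (*-identityˡ (μ (toℕ j) 0)) (μ[n,0]≡1 (toℕ j))
    T[0,r+1]-vanishes : ∀ r → T 0 (suc (toℕ r)) + rest r ≡ rest r
    T[0,r+1]-vanishes r = trans (cong (_+ rest r) (*-zeroʳ ((s C suc (toℕ r)) /1))) (+-identityˡ (rest r))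

open import Defs
open import Data.Nat using (ℕ; _≤_; _∸_; NonZero)
open import Data.Nat.Combinatorics using (_C_)
open import Data.Integer using (+_)
open import Data.Rational using (ℚ; _/_; _+_; _*_; 1ℚ)
open import Data.List using (map)
open import Relation.Binary.PropositionalEquality using (_≡_)
open import Data.Nat using (suc)
open import Data.Rational.Properties using (*-identityˡ; *-assoc; *-distribˡ-+)
open import Relation.Binary.PropositionalEquality using (cong; module ≡-Reasoning)
open Moments using (_/1; 1/n*n≡1; μ-recurrence)

theorem3 : (n s : ℕ) → .{{_ : NonZero n}} → 1 ≤ s →
    μ n s ≡ 1ℚ + ((+ 1) / n) * sumℚ (map (λ r → sumℚ (map (λ j → ((+ (s C r)) / 1) * μ j r) (range1 (n ∸ 1)))) (range1 s))
theorem3 n@(suc m) s _ = begin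
  μ n s                                           ≡⟨ *-identityˡ (μ n s) ⟨
  1ℚ * μ n s                                      ≡⟨ cong (_* μ n s) (1/n*n≡1 n) ⟨
  (1/n * (n /1)) * μ n s                          ≡⟨ *-assoc 1/n (n /1) (μ n s) ⟩
  1/n * ((n /1) * μ n s)                          ≡⟨ cong (1/n *_) (μ-recurrence m s) ⟩
  1/n * (n /1 + moments)                          ≡⟨ *-distribˡ-+ 1/n (n /1) moments ⟩
  1/n * (n /1) + 1/n * moments                    ≡⟨ cong (_+ 1/n * moments) (1/n*n≡1 n) ⟩
  1ℚ + 1/n * moments                              ∎
  where
  open ≡-Reasoning
  1/n : ℚ
  1/n = (+ 1) / n
  moments : ℚ
  moments = sumℚ (map (λ r → sumℚ (map (λ j → ((+ (s C r)) / 1) * μ j r) (range1 m))) (range1 s))
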